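{- Let $G$ be a very well-covered graph with no induced subgraph isomorphic to the cycle $C_4$. Then $G$ has a unique maximum matching, and consequently $(V(G),\Psi(G))$ is a greedoid.
   Context: All graphs are finite and simple. For $X\subseteq V(G)$, $N(X)=\{u\in V(G)-X: N(u)\cap X\neq\emptyset\}$ and $N[X]=X\cup N(X)$. $\alpha(G)$ is the maximum size of a stable set. $G$ is well-covered if all maximal stable sets have the same size; very well-covered if moreover it has no isolated vertices and $|V(G)|=2\alpha(G)$. $S\subseteq V(G)$ is a local maximum stable set if $S$ is a maximum stable set of $G[N[S]]$; $\Psi(G)$ is the family of all local maximum stable sets. A greedoid is a pair $(V,\mathcal{F})$, $\mathcal{F}\subseteq 2^V$ non-empty, with (accessibility) every non-empty $X\in\mathcal{F}$ has $x\in X$ with $X-\{x\}\in\mathcal{F}$, and (exchange) for $X,Y\in\mathcal{F}$, $|X|=|Y|+1$, some $x\in X-Y$ has $Y\cup\{x\}\in\mathcal{F}$. -}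

module Defs where

open import Data.Nat using (ℕ; suc; _≤_; _<_; _*_)
open import Data.Bool using (Bool; true; false)
open import Data.Fin using (Fin; toℕ)
open import Data.Fin.Subset using (Subset; _∈_; _∉_; _⊆_; _∪_; _-_; ⁅_⁆; ∣_∣; Nonempty)
open import Data.List using (List; length; filter; allFin; cartesianProduct)
open import Data.Product using (Σ; ∃; ∃-syntax; _×_; _,_; proj₁; proj₂)
open import Data.Sum using (_⊎_)
open import Relation.Nullary using (¬_)
open import Data.Empty using (⊥)
open import Relation.Nullary.Decidable using (_×-dec_)
open import Relation.Binary.PropositionalEquality using (_≡_; _≢_)
open import Data.Bool.Properties using () renaming (_≟_ to _≟ᵇ_)
import Data.Nat.Properties as ℕP

record Graph (n : ℕ) : Set where
  field
    adj     : Fin n → Fin n → Bool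
    sym     : ∀ u v → adj u v ≡ adj v u
    irrefl  : ∀ v → adj v v ≡ false

module _ {n : ℕ} (G : Graph n) where
  open Graph G

  Adj : Fin n → Fin n → Set
  Adj u v = adj u v ≡ true

  Stable : Subset n → Set
  Stable S = ∀ u v → u ∈ S → v ∈ S → ¬ Adj u v

  MaximalStable : Subset n → Set
  MaximalStable S = Stable S × (∀ T → Stable T → S ⊆ T → T ⊆ S)

  MaximumStable : Subset n → Set
  MaximumStable S = Stable S × (∀ T → Stable T → ∣ T ∣ ≤ ∣ S ∣)

  WellCovered : Set
  WellCovered = ∀ S T → MaximalStable S → MaximalStable T → ∣ S ∣ ≡ ∣ T ∣

  NoIsolated : Set
  NoIsolated = ∀ v → ∃[ u ] Adj v u

  VeryWellCovered : Set
  VeryWellCovered =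
    WellCovered × NoIsolated × (∀ S → MaximumStable S → n ≡ 2 * ∣ S ∣)

  C4Free : Set
  C4Free = ∀ a b c d → a ≢ b → a ≢ c → a ≢ d → b ≢ c → b ≢ d → c ≢ d →
    Adj a b → Adj b c → Adj c d → Adj d a → ¬ Adj a c → ¬ Adj b d → ⊥

  InClosedNbhd : Subset n → Fin n → Set
  InClosedNbhd S v = v ∈ S ⊎ (∃[ u ] (u ∈ S × Adj u v))

  -- S is a local maximum stable set: a maximum stable set of G[N[S]]
  -- (a stable set of G[N[S]] is a stable set of G contained in N[S])
  LocalMaxStable : Subset n → Set
  LocalMaxStable S =
    Stable S × (∀ T → Stable T → (∀ v → v ∈ T → InClosedNbhd S v) → ∣ T ∣ ≤ ∣ S ∣)

  Ψ : Subset n → Set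
  Ψ = LocalMaxStable

  record Matching : Set where
    field
      edge     : Fin n → Fin n → Bool
      edge-sym : ∀ u v → edge u v ≡ edge v u
      edge-adj : ∀ u v → edge u v ≡ true → Adj u v
      disjoint : ∀ u v w → edge u v ≡ true → edge u w ≡ true → v ≡ w

  size : Matching → ℕ
  size M = length (filter (λ p → (toℕ (proj₁ p) ℕP.<? toℕ (proj₂ p))
                                  ×-dec (Matching.edge M (proj₁ p) (proj₂ p) ≟ᵇ true))
                          (cartesianProduct (allFin n) (allFin n)))

  MaximumMatching : Matching → Set
  MaximumMatching M = ∀ M′ → size M′ ≤ size M

  SameMatching : Matching → Matching → Set
  SameMatching M M′ = ∀ u v → Matching.edge M u v ≡ Matching.edge M′ u v

  UniqueMaximumMatching : Set
  UniqueMaximumMatching =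
    ∃[ M ] (MaximumMatching M × (∀ M′ → MaximumMatching M′ → SameMatching M M′))

IsGreedoid : (n : ℕ) → (Subset n → Set) → Set
IsGreedoid n F =
  (∃[ X ] F X) ×
  (∀ X → F X → Nonempty X → ∃[ x ] (x ∈ X × F (X - x))) ×
  (∀ X Y → F X → F Y → ∣ X ∣ ≡ suc ∣ Y ∣ → ∃[ x ] (x ∈ X × x ∉ Y × F (Y ∪ ⁅ x ⁆)))

module Submission where

-- * InducedStableSets: stable sets of induced subgraphs G[U], greedy
--   extension to maximal stable sets, and the deletion U ↦ U ∖ N[v].
-- * C4FreeWellCovered: in a well-covered C4-free graph false twins have no
--   common neighbour.  So deleting N[v] for a vertex v of minimum degree
--   keeps the graph well-covered without isolated vertices, and induction
--   gives 2 α ≤ |V|.  When equality holds (very well-covered) v is pendant,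
--   and induction builds a perfect matching v ↦ mate v.
-- * VeryWellCoveredC4Free: no stable set meets both N(x) and N(mate x), so
--   every matching edge has a pendant end; a maximum matching is perfect and
--   hence consists of the edges {x, mate x}.  Moreover S ∈ Ψ(G) iff S is
--   stable and mate-closed (s ∈ S, s ~ w ⇒ mate w ∈ S), and the greedoid
--   axioms follow from this description.

open import Defs
open import Level using (0ℓ)
open import Function using (_∘_)
open import Data.Nat using (ℕ; zero; suc; _+_; _*_; _≤_; _<_; z≤n; s≤s)
open import Data.Nat.Properties hiding (_≟_)
open import Data.Bool using (Bool; true; false; _∧_; _∨_; not; if_then_else_)
open import Data.Bool.Properties
  using (∧-conicalˡ; ∧-conicalʳ; ∧-identityʳ; ∧-zeroʳ; ¬-not) renaming (_≟_ to _≟ᵇ_)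
open import Data.Fin using (Fin; zero; suc; _≟_; toℕ)
open import Data.Fin.Properties using (any?; all?; ¬∀⟶∃¬; toℕ-injective)
  renaming (suc-injective to fsuc-injective; 0≢1+n to zero≢suc)
open import Data.Fin.Subset using (Subset; ⁅_⁆; _∪_; _─_; ∣_∣; Nonempty)
  renaming (_∈_ to _∈ₛ_; _∉_ to _∉ₛ_; _⊆_ to _⊆ₛ_; _-_ to _-ₛ_; ⊥ to ⊥ₛ)
open import Data.Fin.Subset.Properties using (x∈⁅x⁆; x∈⁅y⁆⇒x≡y)
open import Data.Vec using (_∷_; []; lookup)
import Data.Vec as Vec
open import Data.Vec.Properties using (lookup-replicate; lookup∘tabulate; []=⇒lookup; lookup⇒[]=)
open import Data.List using (List; []; _∷_; length; filter; map; _++_; tabulate; allFin; cartesianProduct)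
open import Data.List.Properties using (filter-++; length-++; map-tabulate)
open import Data.List.Membership.Propositional using () renaming (_∈_ to _∈ˡ_)
open import Data.List.Membership.Propositional.Properties using (∈-allFin)
open import Data.List.Relation.Unary.Any using (here; there)
open import Data.Product using (Σ-syntax; ∃-syntax; _×_; _,_; proj₁; proj₂)
open import Data.Sum using (_⊎_; inj₁; inj₂; [_,_]′)
open import Data.Empty using (⊥; ⊥-elim)
open import Relation.Unary using (Pred; Decidable)
open import Relation.Nullary using (¬_; Dec; yes; no; does)
open import Relation.Nullary.Decidable using (_×-dec_; _→-dec_; ¬?; decidable-stable; dec-true; dec-false)
open import Relation.Binary.PropositionalEquality
open import Relation.Binary.Definitions using (tri<; tri≈; tri>)
open import Algebra.Properties.CommutativeMonoid.Sum +-0-commutativeMonoid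
  using (sum; sum-cong-≗; sum-replicate-zero; ∑-distrib-+; ∑-comm)

-- Subsets of Fin n are represented by their characteristic functions
-- Fin n → Bool, which makes set comprehension and counting easy.
module Counting where

  true≢false : true ≡ false → ⊥
  true≢false ()

  ∧-true : ∀ {a b} → a ∧ b ≡ true → a ≡ true × b ≡ true
  ∧-true {a} e = ∧-conicalˡ a _ e , ∧-conicalʳ a _ e

  ∧-intro : ∀ {a b} → a ≡ true → b ≡ true → a ∧ b ≡ true
  ∧-intro refl refl = refl

  ∨-true : ∀ {a b} → a ∨ b ≡ true → a ≡ true ⊎ b ≡ true
  ∨-true {true} _ = inj₁ refl
  ∨-true {false} e = inj₂ e

  bool-ext : ∀ {a b} → (a ≡ true → b ≡ true) → (b ≡ true → a ≡ true) → a ≡ b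
  bool-ext {true} f _ = sym (f refl)
  bool-ext {false} {true} _ g = g refl
  bool-ext {false} {false} _ _ = refl

  _≐_ : ∀ {n} → Fin n → Fin n → Bool
  i ≐ j = does (i ≟ j)

  ≐-refl : ∀ {n} (i : Fin n) → (i ≐ i) ≡ true
  ≐-refl i = dec-true (i ≟ i) refl

  ≐-true : ∀ {n} {i j : Fin n} → (i ≐ j) ≡ true → i ≡ j
  ≐-true {i = i} {j} e with i ≟ j
  ... | yes i≡j = i≡j

  ≐-false : ∀ {n} {i j : Fin n} → i ≢ j → (i ≐ j) ≡ false
  ≐-false {i = i} {j} = dec-false (i ≟ j)

  ≐-false⁻ : ∀ {n} {i j : Fin n} → (i ≐ j) ≡ false → i ≢ j
  ≐-false⁻ {i = i} e refl = true≢false (trans (sym (≐-refl i)) e)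

  ≐-sym : ∀ {n} (i j : Fin n) → (i ≐ j) ≡ (j ≐ i)
  ≐-sym i j with i ≟ j | j ≟ i
  ... | yes _ | yes _ = refl
  ... | no _ | no _ = refl
  ... | yes i≡j | no j≢i = ⊥-elim (j≢i (sym i≡j))
  ... | no i≢j | yes j≡i = ⊥-elim (i≢j (sym j≡i))

  _⊑_ : ∀ {n} → (Fin n → Bool) → (Fin n → Bool) → Set
  X ⊑ Y = ∀ i → X i ≡ true → Y i ≡ true

  ∅ : ∀ {n} → Fin n → Bool
  ∅ _ = false

  full : ∀ {n} → Fin n → Bool
  full _ = true

  insert : ∀ {n} → (Fin n → Bool) → Fin n → Fin n → Bool
  insert X v i = X i ∨ (i ≐ v)

  delete : ∀ {n} → (Fin n → Bool) → Fin n → Fin n → Bool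
  delete X v i = X i ∧ not (i ≐ v)

  module _ {n : ℕ} (X : Fin n → Bool) (v : Fin n) where
    insert-here : insert X v v ≡ true
    insert-here with X v
    ... | true = refl
    ... | false = ≐-refl v

    insert-old : ∀ i → X i ≡ true → insert X v i ≡ true
    insert-old i e rewrite e = refl

    insert-el : ∀ i → insert X v i ≡ true → X i ≡ true ⊎ i ≡ v
    insert-el i e with ∨-true {X i} e
    ... | inj₁ x = inj₁ x
    ... | inj₂ eq = inj₂ (≐-true eq)

    insert-false : ∀ i → insert X v i ≡ false → X i ≡ false × i ≢ v
    insert-false i e with X i | i ≐ v in eq
    ... | false | false = refl , ≐-false⁻ eq

    delete-intro : ∀ {i} → X i ≡ true → i ≢ v → delete X v i ≡ true
    delete-intro x ne rewrite x | ≐-false ne = refl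

    delete-el : ∀ {i} → delete X v i ≡ true → X i ≡ true × i ≢ v
    delete-el {i} e with X i | i ≐ v in eq
    delete-el () | false | _
    delete-el () | true | true
    delete-el _ | true | false = refl , ≐-false⁻ eq

  sum-mono : ∀ {n} {f g : Fin n → ℕ} → (∀ i → f i ≤ g i) → sum f ≤ sum g
  sum-mono {zero} _ = z≤n
  sum-mono {suc n} le = +-mono-≤ (le zero) (sum-mono (le ∘ suc))

  sum-zero : ∀ {n} {f : Fin n → ℕ} → (∀ i → f i ≡ 0) → sum f ≡ 0
  sum-zero {n} z = trans (sum-cong-≗ z) (sum-replicate-zero n)

  sum≤n : ∀ {n} {f : Fin n → ℕ} → (∀ i → f i ≤ 1) → sum f ≤ n
  sum≤n {zero} _ = z≤n
  sum≤n {suc n} le = +-mono-≤ (le zero) (sum≤n (le ∘ suc))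

  sum≥n⇒all-one : ∀ {n} {f : Fin n → ℕ} → (∀ i → f i ≤ 1) → n ≤ sum f → ∀ i → f i ≡ 1
  sum≥n⇒all-one {suc n} {f} le h i with f zero in eq | le zero
  ... | zero | _ = ⊥-elim (<-irrefl refl (≤-trans h (sum≤n (le ∘ suc))))
  ... | suc zero | _ with i
  ...   | zero = eq
  ...   | suc i′ = sum≥n⇒all-one (le ∘ suc) (≤-pred h) i′
  sum≥n⇒all-one le h i | suc (suc _) | s≤s ()

  sum-positive : ∀ {n} {f : Fin n → ℕ} → 0 < sum f → ∃[ i ] 0 < f i
  sum-positive {suc n} {f} p with f zero in eq
  ... | suc _ = zero , subst (0 <_) (sym eq) (s≤s z≤n)
  ... | zero with sum-positive {f = f ∘ suc} p
  ...   | i , q = suc i , q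

  bit : Bool → ℕ
  bit true = 1
  bit false = 0

  bit≤1 : ∀ b → bit b ≤ 1
  bit≤1 true = s≤s z≤n
  bit≤1 false = z≤n

  count : ∀ {n} → (Fin n → Bool) → ℕ
  count X = sum (bit ∘ X)

  module _ {n : ℕ} where
    count-cong : {X Y : Fin n → Bool} → (∀ i → X i ≡ Y i) → count X ≡ count Y
    count-cong e = sum-cong-≗ (cong bit ∘ e)

    count-mono : {X Y : Fin n → Bool} → X ⊑ Y → count X ≤ count Y
    count-mono {X} {Y} X⊑Y = sum-mono pointwise where
      pointwise : ∀ i → bit (X i) ≤ bit (Y i)
      pointwise i with X i in eq
      ... | false = z≤n
      ... | true rewrite X⊑Y i eq = ≤-refl

    count-empty : {X : Fin n → Bool} → (∀ i → X i ≡ false) → count X ≡ 0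
    count-empty e = sum-zero (cong bit ∘ e)

    count≤n : (X : Fin n → Bool) → count X ≤ n
    count≤n X = sum≤n (bit≤1 ∘ X)

    count-full : count {n} full ≡ n
    count-full = go n where
      go : ∀ m → count {m} full ≡ m
      go zero = refl
      go (suc m) = cong suc (go m)

  count-split : ∀ {n} (X Y : Fin n → Bool) →
    count X ≡ count (λ i → X i ∧ Y i) + count (λ i → X i ∧ not (Y i))
  count-split X Y = trans (sum-cong-≗ pointwise)
    (∑-distrib-+ (λ i → bit (X i ∧ Y i)) (λ i → bit (X i ∧ not (Y i))))
    where
    pointwise : ∀ i → bit (X i) ≡ bit (X i ∧ Y i) + bit (X i ∧ not (Y i))
    pointwise i with X i | Y i
    ... | true | true = refl
    ... | true | false = refl
    ... | false | _ = refl

  count-∪ : ∀ {n} (X Y : Fin n → Bool) → (∀ i → X i ≡ true → Y i ≡ false) →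
    count (λ i → X i ∨ Y i) ≡ count X + count Y
  count-∪ X Y disjoint = trans (sum-cong-≗ pointwise) (∑-distrib-+ (bit ∘ X) (bit ∘ Y))
    where
    pointwise : ∀ i → bit (X i ∨ Y i) ≡ bit (X i) + bit (Y i)
    pointwise i with X i in eqX | Y i in eqY
    ... | false | _ = refl
    ... | true | true = ⊥-elim (true≢false (trans (sym eqY) (disjoint i eqX)))
    ... | true | false = refl

  count-nonempty : ∀ {n} {X : Fin n → Bool} → 0 < count X → ∃[ i ] X i ≡ true
  count-nonempty {X = X} p with sum-positive {f = bit ∘ X} p
  ... | i , q = i , bit-positive (X i) q where
    bit-positive : ∀ b → 0 < bit b → b ≡ true
    bit-positive true _ = refl

  count-≥1 : ∀ {n} {X : Fin n → Bool} (v : Fin n) → X v ≡ true → 1 ≤ count X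
  count-≥1 {suc n} {X} zero e rewrite e = s≤s z≤n
  count-≥1 {suc n} {X} (suc v) e = ≤-trans (count-≥1 {X = X ∘ suc} v e) (m≤n+m _ _)

  count-≤1 : ∀ {n} {X : Fin n → Bool} → (∀ i j → X i ≡ true → X j ≡ true → i ≡ j) → count X ≤ 1
  count-≤1 {zero} _ = z≤n
  count-≤1 {suc n} {X} unique with X zero in eq
  ... | true = ≤-reflexive (cong suc (count-empty {X = X ∘ suc} rest-empty))
    where
    rest-empty : ∀ i → X (suc i) ≡ false
    rest-empty i = ¬-not λ x → zero≢suc (unique zero (suc i) eq x)
  ... | false = count-≤1 {X = X ∘ suc} (λ i j x y → fsuc-injective (unique (suc i) (suc j) x y))

  count-singleton : ∀ {n} (v : Fin n) → count (_≐ v) ≡ 1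
  count-singleton v = ≤-antisym
    (count-≤1 {X = _≐ v} (λ i j x y → trans (≐-true x) (sym (≐-true y))))
    (count-≥1 v (≐-refl v))

  count-insert : ∀ {n} (X : Fin n → Bool) v → X v ≡ false → count (insert X v) ≡ suc (count X)
  count-insert X v Xv = begin
    count (insert X v)       ≡⟨ count-∪ X (_≐ v) disjoint ⟩
    count X + count (_≐ v)   ≡⟨ cong (count X +_) (count-singleton v) ⟩
    count X + 1              ≡⟨ +-comm (count X) 1 ⟩
    suc (count X)            ∎
    where
    open ≡-Reasoning
    disjoint : ∀ i → X i ≡ true → (i ≐ v) ≡ false
    disjoint i x = ≐-false λ i≡v → true≢false (trans (sym x) (trans (cong X i≡v) Xv))

  count-delete : ∀ {n} (X : Fin n → Bool) v → X v ≡ true → count X ≡ suc (count (delete X v))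
  count-delete X v Xv = begin
    count X                                        ≡⟨ count-split X (_≐ v) ⟩
    count (λ i → X i ∧ (i ≐ v)) + count (delete X v) ≡⟨ cong (_+ count (delete X v)) just-v ⟩
    suc (count (delete X v))                       ∎
    where
    open ≡-Reasoning
    pointwise : ∀ i → (X i ∧ (i ≐ v)) ≡ (i ≐ v)
    pointwise i with i ≐ v in eq
    ... | true = trans (∧-identityʳ (X i)) (subst (λ k → X k ≡ true) (sym (≐-true eq)) Xv)
    ... | false with X i
    ...   | true = refl
    ...   | false = refl
    just-v : count (λ i → X i ∧ (i ≐ v)) ≡ 1
    just-v = trans (count-cong pointwise) (count-singleton v)

  count-two : ∀ {n} {X : Fin n → Bool} (a b : Fin n) → X a ≡ true → X b ≡ true → a ≢ b → 2 ≤ count X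
  count-two {X = X} a b Xa Xb a≢b = subst (2 ≤_) (sym (count-delete X a Xa))
    (s≤s (count-≥1 b (delete-intro X a Xb (λ e → a≢b (sym e)))))

  count-strict : ∀ {n} {X Y : Fin n → Bool} (v : Fin n) → X ⊑ Y → Y v ≡ true → X v ≡ false →
    suc (count X) ≤ count Y
  count-strict {X = X} {Y} v X⊑Y Yv Xv =
    subst (_≤ count Y) (count-insert X v Xv) (count-mono insert⊑Y)
    where
    insert⊑Y : insert X v ⊑ Y
    insert⊑Y i e with insert-el X v i e
    ... | inj₁ x = X⊑Y i x
    ... | inj₂ refl = Yv

  count-⊑-reverse : ∀ {n} {X Y : Fin n → Bool} → X ⊑ Y → count Y ≤ count X → Y ⊑ X
  count-⊑-reverse {X = X} X⊑Y le i Yi with X i in eq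
  ... | true = refl
  ... | false = ⊥-elim (<-irrefl refl (≤-trans (count-strict i X⊑Y Yi eq) le))

  count-injection : ∀ {n} {X Y : Fin n → Bool} (h : Fin n → Fin n) →
    (∀ i → X i ≡ true → Y (h i) ≡ true) →
    (∀ i j → X i ≡ true → X j ≡ true → h i ≡ h j → i ≡ j) → count X ≤ count Y
  count-injection {n} {X} {Y} h into injective = begin
    count X                                            ≡⟨ sum-cong-≗ row ⟩
    sum (λ i → sum (λ j → bit (X i ∧ (h i ≐ j))))      ≡⟨ ∑-comm (λ i j → bit (X i ∧ (h i ≐ j))) ⟩
    sum (λ j → count (λ i → X i ∧ (h i ≐ j)))          ≤⟨ sum-mono column ⟩
    count Y                                            ∎
    where
    open ≤-Reasoning
    row : ∀ i → bit (X i) ≡ sum (λ j → bit (X i ∧ (h i ≐ j)))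
    row i with X i
    ... | true = sym (trans (count-cong (λ j → ≐-sym (h i) j)) (count-singleton (h i)))
    ... | false = sym (sum-zero {n} (λ _ → refl))
    column : ∀ j → count (λ i → X i ∧ (h i ≐ j)) ≤ bit (Y j)
    column j with Y j in eq
    ... | true = count-≤1 λ a b x y →
            let (Xa , ha) = ∧-true x ; (Xb , hb) = ∧-true y in
            injective a b Xa Xb (trans (≐-true ha) (sym (≐-true hb)))
    ... | false = ≤-reflexive (count-empty outside) where
      outside : ∀ i → (X i ∧ (h i ≐ j)) ≡ false
      outside i with X i in Xi | h i ≐ j in hi
      ... | true | true = ⊥-elim (true≢false (trans (sym (into i Xi)) (trans (cong Y (≐-true hi)) eq)))
      ... | true | false = refl
      ... | false | _ = refl

  image : ∀ {n} → (Fin n → Bool) → (Fin n → Fin n) → Fin n → Bool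
  image X h i = does (any? λ t → (X t ≟ᵇ true) ×-dec (h t ≟ i))

  module _ {n : ℕ} (X : Fin n → Bool) (h : Fin n → Fin n) where
    image-el : ∀ {i} → image X h i ≡ true → ∃[ t ] (X t ≡ true × h t ≡ i)
    image-el {i} e with any? (λ t → (X t ≟ᵇ true) ×-dec (h t ≟ i))
    ... | yes witness = witness

    image-in : ∀ {t} → X t ≡ true → image X h (h t) ≡ true
    image-in {t} Xt = dec-true (any? λ u → (X u ≟ᵇ true) ×-dec (h u ≟ h t)) (t , Xt , refl)

    count-image : (∀ i j → X i ≡ true → X j ≡ true → h i ≡ h j → i ≡ j) → count X ≤ count (image X h)
    count-image = count-injection h (λ _ → image-in)

  module _ {A : Set} {P : Pred A 0ℓ} (P? : Decidable P) where
    length-filter-++ : ∀ xs ys → length (filter P? (xs ++ ys)) ≡ length (filter P? xs) + length (filter P? ys)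
    length-filter-++ xs ys = trans (cong length (filter-++ P? xs ys)) (length-++ (filter P? xs))

    length-filter-tabulate : ∀ {m} (g : Fin m → A) →
      length (filter P? (tabulate g)) ≡ sum (λ i → bit (does (P? (g i))))
    length-filter-tabulate {zero} g = refl
    length-filter-tabulate {suc m} g with does (P? (g zero))
    ... | true = cong suc (length-filter-tabulate (g ∘ suc))
    ... | false = length-filter-tabulate (g ∘ suc)

  length-filter-pairs : ∀ {n} {P : Pred (Fin n × Fin n) 0ℓ} (P? : Decidable P) →
    length (filter P? (cartesianProduct (allFin n) (allFin n))) ≡
    sum (λ i → sum (λ j → bit (does (P? (i , j)))))
  length-filter-pairs {n} P? = rows (λ i → i)
    where
    rows : ∀ {m} (g : Fin m → Fin n) →
      length (filter P? (cartesianProduct (tabulate g) (allFin n))) ≡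
      sum (λ i → sum (λ j → bit (does (P? (g i , j)))))
    rows {zero} g = refl
    rows {suc m} g = begin
      length (filter P? (map (g zero ,_) (allFin n) ++ cartesianProduct (tabulate (g ∘ suc)) (allFin n)))
        ≡⟨ length-filter-++ P? (map (g zero ,_) (allFin n)) _ ⟩
      length (filter P? (map (g zero ,_) (allFin n))) + _
        ≡⟨ cong₂ _+_ (trans (cong (length ∘ filter P?) (map-tabulate (λ j → j) (g zero ,_)))
                            (length-filter-tabulate P? (g zero ,_)))
                     (rows (g ∘ suc)) ⟩
      sum (λ j → bit (does (P? (g zero , j)))) + sum (λ i → sum (λ j → bit (does (P? (g (suc i) , j))))) ∎
      where open ≡-Reasoning

module SubsetsAsFunctions where
  open Counting

  module _ {n : ℕ} where
    ∈⇒true : ∀ (X : Subset n) {i} → i ∈ₛ X → lookup X i ≡ true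
    ∈⇒true X = []=⇒lookup

    true⇒∈ : ∀ (X : Subset n) {i} → lookup X i ≡ true → i ∈ₛ X
    true⇒∈ X {i} = lookup⇒[]= i X

    fromFunction : (Fin n → Bool) → Subset n
    fromFunction = Vec.tabulate

    lookup-fromFunction : ∀ X i → lookup (fromFunction X) i ≡ X i
    lookup-fromFunction = lookup∘tabulate

  ∣∣≡count : ∀ {n} (X : Subset n) → ∣ X ∣ ≡ count (lookup X)
  ∣∣≡count [] = refl
  ∣∣≡count (true ∷ X) = cong suc (∣∣≡count X)
  ∣∣≡count (false ∷ X) = ∣∣≡count X

  ∣fromFunction∣ : ∀ {n} (X : Fin n → Bool) → ∣ fromFunction X ∣ ≡ count X
  ∣fromFunction∣ X = trans (∣∣≡count (fromFunction X)) (count-cong (lookup-fromFunction X))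

  lookup-⊥ : ∀ {n} (i : Fin n) → lookup ⊥ₛ i ≡ false
  lookup-⊥ i = lookup-replicate i false

  lookup-⁅⁆ : ∀ {n} (x i : Fin n) → lookup ⁅ x ⁆ i ≡ (i ≐ x)
  lookup-⁅⁆ x i = bool-ext
    (λ e → subst (λ j → (j ≐ x) ≡ true) (sym (x∈⁅y⁆⇒x≡y x (true⇒∈ ⁅ x ⁆ e))) (≐-refl x))
    (λ e → ∈⇒true ⁅ x ⁆ (subst (_∈ₛ ⁅ x ⁆) (sym (≐-true e)) (x∈⁅x⁆ x)))

  lookup-∪ : ∀ {n} (X Y : Subset n) i → lookup (X ∪ Y) i ≡ (lookup X i ∨ lookup Y i)
  lookup-∪ (a ∷ X) (b ∷ Y) zero = refl
  lookup-∪ (a ∷ X) (b ∷ Y) (suc i) = lookup-∪ X Y i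

  lookup-─ : ∀ {n} (X Y : Subset n) i → lookup (X ─ Y) i ≡ (lookup X i ∧ not (lookup Y i))
  lookup-─ (a ∷ X) (true ∷ Y) zero = sym (∧-zeroʳ a)
  lookup-─ (a ∷ X) (false ∷ Y) zero = sym (∧-identityʳ a)
  lookup-─ (a ∷ X) (b ∷ Y) (suc i) = lookup-─ X Y i

  lookup-∪⁅⁆ : ∀ {n} (X : Subset n) x i → lookup (X ∪ ⁅ x ⁆) i ≡ insert (lookup X) x i
  lookup-∪⁅⁆ X x i = trans (lookup-∪ X ⁅ x ⁆ i) (cong (lookup X i ∨_) (lookup-⁅⁆ x i))

  lookup-- : ∀ {n} (X : Subset n) x i → lookup (X -ₛ x) i ≡ delete (lookup X) x i
  lookup-- X x i = trans (lookup-─ X ⁅ x ⁆ i) (cong (λ b → lookup X i ∧ not b) (lookup-⁅⁆ x i))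

-- Stable sets of the subgraph G[U] induced by a vertex set U.  All the
-- induction in the proof runs over such induced subgraphs.
module InducedStableSets {n : ℕ} (G : Graph n) where
  open Counting
  open Graph G using (adj; irrefl)

  adj-sym : ∀ {a b} → adj a b ≡ true → adj b a ≡ true
  adj-sym {a} {b} e = trans (sym (Graph.sym G a b)) e

  adj-sym-false : ∀ {a b} → adj a b ≡ false → adj b a ≡ false
  adj-sym-false {a} {b} e = trans (sym (Graph.sym G a b)) e

  adj⇒≢ : ∀ {a b} → adj a b ≡ true → a ≢ b
  adj⇒≢ {a} e refl = true≢false (trans (sym e) (irrefl a))

  IsStable : (Fin n → Bool) → Set
  IsStable X = ∀ a b → X a ≡ true → X b ≡ true → adj a b ≡ false

  Dominates : (Fin n → Bool) → (Fin n → Bool) → Set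
  Dominates U X = ∀ w → U w ≡ true → X w ≡ false → ∃[ u ] (X u ≡ true × adj w u ≡ true)

  -- a stable set of G[U] is maximal iff it dominates U
  MaximalStableIn : (Fin n → Bool) → (Fin n → Bool) → Set
  MaximalStableIn U X = X ⊑ U × IsStable X × Dominates U X

  WellCoveredOn : (Fin n → Bool) → Set
  WellCoveredOn U = ∀ X Y → MaximalStableIn U X → MaximalStableIn U Y → count X ≡ count Y

  NoIsolatedOn : (Fin n → Bool) → Set
  NoIsolatedOn U = ∀ v → U v ≡ true → ∃[ u ] (U u ≡ true × adj v u ≡ true)

  stable-insert : ∀ X v → IsStable X → (∀ b → X b ≡ true → adj v b ≡ false) → IsStable (insert X v)
  stable-insert X v st v-free a b ea eb with insert-el X v a ea | insert-el X v b eb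
  ... | inj₁ xa | inj₁ xb = st a b xa xb
  ... | inj₁ xa | inj₂ refl = adj-sym-false (v-free a xa)
  ... | inj₂ refl | inj₁ xb = v-free b xb
  ... | inj₂ refl | inj₂ refl = irrefl a

  stable-insert-pair : ∀ U T u v → T ⊑ U → IsStable T → U u ≡ true → U v ≡ true →
    T u ≡ false → T v ≡ false → u ≢ v → adj u v ≡ false →
    (∀ b → T b ≡ true → adj u b ≡ false) → (∀ b → T b ≡ true → adj v b ≡ false) →
    insert (insert T u) v ⊑ U × IsStable (insert (insert T u) v) ×
    count (insert (insert T u) v) ≡ suc (suc (count T))
  stable-insert-pair U T u v T⊑U st Uu Uv Tu Tv u≢v uv u-free v-free = ⊑U , stable , counted
    where
    ⊑U : insert (insert T u) v ⊑ U
    ⊑U i e with insert-el (insert T u) v i e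
    ... | inj₂ refl = Uv
    ... | inj₁ e′ with insert-el T u i e′
    ...   | inj₂ refl = Uu
    ...   | inj₁ Ti = T⊑U i Ti
    v-free′ : ∀ b → insert T u b ≡ true → adj v b ≡ false
    v-free′ b e with insert-el T u b e
    ... | inj₁ Tb = v-free b Tb
    ... | inj₂ refl = adj-sym-false uv
    stable : IsStable (insert (insert T u) v)
    stable = stable-insert (insert T u) v (stable-insert T u st u-free) v-free′
    v∉T+u : insert T u v ≡ false
    v∉T+u = ¬-not λ e → [ (λ Tv′ → true≢false (trans (sym Tv′) Tv)) , (λ v≡u → u≢v (sym v≡u)) ]′
                           (insert-el T u v e)
    counted : count (insert (insert T u) v) ≡ suc (suc (count T))
    counted = trans (count-insert (insert T u) v v∉T+u) (cong suc (count-insert T u Tu))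

  -- Every stable subset of U extends to a maximal stable set of G[U]:
  -- scan the vertices once, adding each vertex of U that is still free.
  module GreedyExtension (U : Fin n → Bool) where
    Addable : (Fin n → Bool) → Fin n → Set
    Addable X v = U v ≡ true × X v ≡ false × (∀ i → X i ≡ true → adj v i ≡ false)

    addable? : ∀ X v → Dec (Addable X v)
    addable? X v = (U v ≟ᵇ true) ×-dec (X v ≟ᵇ false) ×-dec
                   all? (λ i → (X i ≟ᵇ true) →-dec (adj v i ≟ᵇ false))

    blocked : ∀ X v → U v ≡ true → X v ≡ false → ¬ Addable X v → ∃[ u ] (X u ≡ true × adj v u ≡ true)
    blocked X v Uv Xv ¬add with ¬∀⟶∃¬ n _ (λ i → (X i ≟ᵇ true) →-dec (adj v i ≟ᵇ false))
                                        (λ free → ¬add (Uv , Xv , free))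
    ... | u , u-blocks with X u in Xu | adj v u in vu
    ...   | true | true = u , Xu , vu
    ...   | true | false = ⊥-elim (u-blocks (λ _ → refl))
    ...   | false | _ = ⊥-elim (u-blocks (λ ()))

    scan : List (Fin n) → (Fin n → Bool) → Fin n → Bool
    scan [] X = X
    scan (v ∷ vs) X with addable? X v
    ... | yes _ = scan vs (insert X v)
    ... | no _ = scan vs X

    scan-spec : ∀ vs X → X ⊑ U → IsStable X →
      scan vs X ⊑ U × IsStable (scan vs X) × X ⊑ scan vs X ×
      (∀ w → w ∈ˡ vs → U w ≡ true → scan vs X w ≡ false → ∃[ u ] (scan vs X u ≡ true × adj w u ≡ true))
    scan-spec [] X sub st = sub , st , (λ _ e → e) , λ _ ()
    scan-spec (v ∷ vs) X sub st with addable? X v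
    ... | yes (Uv , Xv , free) =
      let (sub′ , st′ , grows , dom) = scan-spec vs (insert X v) insert⊑U (stable-insert X v st free)
      in sub′ , st′ , (λ i e → grows i (insert-old X v i e)) ,
         λ { w (here refl) _ Yw → ⊥-elim (true≢false (trans (sym (grows w (insert-here X w))) Yw))
           ; w (there w∈vs) Uw Yw → dom w w∈vs Uw Yw }
      where
      insert⊑U : insert X v ⊑ U
      insert⊑U i e with insert-el X v i e
      ... | inj₁ x = sub i x
      ... | inj₂ refl = Uv
    ... | no ¬add =
      let (sub′ , st′ , grows , dom) = scan-spec vs X sub st
      in sub′ , st′ , grows ,
         λ { w (here refl) Uw Yw → here-case grows Uw Yw
           ; w (there w∈vs) Uw Yw → dom w w∈vs Uw Yw }
      where
      here-case : X ⊑ scan vs X → U v ≡ true → scan vs X v ≡ false →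
                  ∃[ u ] (scan vs X u ≡ true × adj v u ≡ true)
      here-case grows Uv Yv with blocked X v Uv Xv ¬add
        where Xv = ¬-not λ x → true≢false (trans (sym (grows v x)) Yv)
      ... | u , Xu , vu = u , grows u Xu , vu

  extendToMaximal : ∀ U X → X ⊑ U → IsStable X →
    Σ[ Y ∈ (Fin n → Bool) ] (MaximalStableIn U Y × X ⊑ Y)
  extendToMaximal U X sub st =
    let (sub′ , st′ , grows , dom) = scan-spec (allFin n) X sub st
    in scan (allFin n) X , (sub′ , st′ , λ w → dom w (∈-allFin w)) , grows
    where open GreedyExtension U

  someMaximal : ∀ U → Σ[ Y ∈ (Fin n → Bool) ] MaximalStableIn U Y
  someMaximal U with extendToMaximal U ∅ (λ _ ()) (λ _ _ ())
  ... | Y , maxY , _ = Y , maxY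

  _∖N[_] : (Fin n → Bool) → Fin n → Fin n → Bool
  (U ∖N[ v ]) i = delete U v i ∧ not (adj v i)

  ∖N-el : ∀ U v {i} → (U ∖N[ v ]) i ≡ true → U i ≡ true × i ≢ v × adj v i ≡ false
  ∖N-el U v {i} e with ∧-true {delete U v i} e
  ... | d , a with delete-el U v d
  ...   | Ui , i≢v = Ui , i≢v , ¬-not (λ a′ → true≢false (trans (sym a) (cong not a′)))

  ∖N-intro : ∀ U v {i} → U i ≡ true → i ≢ v → adj v i ≡ false → (U ∖N[ v ]) i ≡ true
  ∖N-intro U v Ui i≢v a rewrite delete-intro U v Ui i≢v | a = refl

  maximal-insert : ∀ U v X → U v ≡ true → MaximalStableIn (U ∖N[ v ]) X → MaximalStableIn U (insert X v)
  maximal-insert U v X Uv (sub , st , dom) = sub′ , stable-insert X v st v-free , dom′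
    where
    sub′ : insert X v ⊑ U
    sub′ i e with insert-el X v i e
    ... | inj₁ x = proj₁ (∖N-el U v (sub i x))
    ... | inj₂ refl = Uv
    v-free : ∀ b → X b ≡ true → adj v b ≡ false
    v-free b x = proj₂ (proj₂ (∖N-el U v (sub b x)))
    dom′ : Dominates U (insert X v)
    dom′ w Uw Yw with insert-false X v w Yw | adj w v in wv
    ... | _ | true = v , insert-here X v , wv
    ... | Xw , w≢v | false with dom w (∖N-intro U v Uw w≢v (adj-sym-false wv)) Xw
    ...   | u , Xu , wu = u , insert-old X v u Xu , wu

  ∉-maximal-∖N : ∀ U v X → MaximalStableIn (U ∖N[ v ]) X → X v ≡ false
  ∉-maximal-∖N U v X (sub , _) = ¬-not λ Xv → proj₁ (proj₂ (∖N-el U v (sub v Xv))) refl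

  wellCovered-∖N : ∀ U v → U v ≡ true → WellCoveredOn U → WellCoveredOn (U ∖N[ v ])
  wellCovered-∖N U v Uv wc X Y maxX maxY = suc-injective (begin
    suc (count X)          ≡⟨ count-insert X v (∉-maximal-∖N U v X maxX) ⟨
    count (insert X v)     ≡⟨ wc _ _ (maximal-insert U v X Uv maxX) (maximal-insert U v Y Uv maxY) ⟩
    count (insert Y v)     ≡⟨ count-insert Y v (∉-maximal-∖N U v Y maxY) ⟩
    suc (count Y)          ∎)
    where open ≡-Reasoning

  degree : (Fin n → Bool) → Fin n → ℕ
  degree U v = count (λ i → U i ∧ adj v i)

  count-∖N : ∀ U v → U v ≡ true → count U ≡ suc (degree U v + count (U ∖N[ v ]))
  count-∖N U v Uv = begin
    count U                                                   ≡⟨ count-delete U v Uv ⟩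
    suc (count (delete U v))                                  ≡⟨ cong suc (count-split (delete U v) (adj v)) ⟩
    suc (count (λ i → delete U v i ∧ adj v i) + count (U ∖N[ v ]))
      ≡⟨ cong (λ d → suc (d + count (U ∖N[ v ]))) (count-cong nbrs) ⟩
    suc (degree U v + count (U ∖N[ v ]))                      ∎
    where
    open ≡-Reasoning
    nbrs : ∀ i → (delete U v i ∧ adj v i) ≡ (U i ∧ adj v i)
    nbrs i with i ≐ v in eq
    ... | false = cong (_∧ adj v i) (∧-identityʳ (U i))
    ... | true with ≐-true {i = i} {j = v} eq
    ...   | refl rewrite irrefl i = trans (∧-zeroʳ _) (sym (∧-zeroʳ (U i)))

  minDegreeVertex : ∀ U i → U i ≡ true → ∃[ v ] (U v ≡ true × ∀ u → U u ≡ true → degree U v ≤ degree U u)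
  minDegreeVertex U i Ui = descend (degree U i) i ≤-refl Ui
    where
    -- descend along vertices of strictly smaller degree; the bound k decreases
    descend : ∀ k i → degree U i ≤ k → U i ≡ true →
      ∃[ v ] (U v ≡ true × ∀ u → U u ≡ true → degree U v ≤ degree U u)
    descend k i bound Ui with any? (λ u → (U u ≟ᵇ true) ×-dec (degree U u <? degree U i))
    ... | no none-smaller = i , Ui , λ u Uu → ≮⇒≥ (λ lt → none-smaller (u , Uu , lt))
    descend zero i bound Ui | yes (u , Uu , lt) = ⊥-elim (n≮0 (≤-trans lt bound))
    descend (suc k) i bound Ui | yes (u , Uu , lt) = descend k u (≤-pred (≤-trans lt bound)) Uu

  emptyOrMinDegree : ∀ U → (∀ i → U i ≡ false) ⊎
    ∃[ v ] (U v ≡ true × ∀ u → U u ≡ true → degree U v ≤ degree U u)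
  emptyOrMinDegree U with any? (λ i → U i ≟ᵇ true)
  ... | yes (i , Ui) = inj₂ (minDegreeVertex U i Ui)
  ... | no empty = inj₁ λ i → ¬-not λ Ui → empty (i , Ui)

  ∖N-out : ∀ U v {i} → U i ≡ true → (U ∖N[ v ]) i ≡ false → i ≡ v ⊎ adj v i ≡ true
  ∖N-out U v {i} Ui out = by-adjacency (adj v i) refl
    where
    by-adjacency : ∀ b → adj v i ≡ b → i ≡ v ⊎ adj v i ≡ true
    by-adjacency true vi = inj₂ vi
    by-adjacency false vi = inj₁ (decidable-stable (i ≟ v) λ i≢v →
      true≢false (trans (sym (∖N-intro U v Ui i≢v vi)) out))

  PerfectMatchingOn : (Fin n → Bool) → Set
  PerfectMatchingOn U = Σ[ p ∈ (Fin n → Fin n) ]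
    (∀ v → U v ≡ true → U (p v) ≡ true × adj v (p v) ≡ true × p (p v) ≡ v)

  extend-matching : ∀ U v s → U v ≡ true → U s ≡ true → adj v s ≡ true →
    (∀ i → U i ≡ true → adj v i ≡ true → i ≡ s) →
    PerfectMatchingOn (U ∖N[ v ]) → PerfectMatchingOn U
  extend-matching U v s Uv Us vs unique (p′ , p′-matches) = p , p-matches
    where
    s≢v : s ≢ v
    s≢v s≡v = adj⇒≢ vs (sym s≡v)
    p : Fin n → Fin n
    p i = if i ≐ v then s else if i ≐ s then v else p′ i
    p-v : p v ≡ s
    p-v rewrite ≐-refl v = refl
    p-s : p s ≡ v
    p-s rewrite ≐-false s≢v | ≐-refl s = refl
    p-other : ∀ i → i ≢ v → i ≢ s → p i ≡ p′ i
    p-other i i≢v i≢s rewrite ≐-false i≢v | ≐-false i≢s = refl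
    into-∖N : ∀ {i} → U i ≡ true → i ≢ v → i ≢ s → (U ∖N[ v ]) i ≡ true
    into-∖N Ui i≢v i≢s = ∖N-intro U v Ui i≢v (¬-not λ vi → i≢s (unique _ Ui vi))
    out-of-∖N : ∀ {i} → (U ∖N[ v ]) i ≡ true → U i ≡ true × i ≢ v × i ≢ s
    out-of-∖N e with ∖N-el U v e
    ... | Ui , i≢v , vi = Ui , i≢v , λ { refl → true≢false (trans (sym vs) vi) }
    Matched : Fin n → Fin n → Set
    Matched w z = U z ≡ true × adj w z ≡ true × p z ≡ w
    p-matches : ∀ w → U w ≡ true → Matched w (p w)
    p-matches w Uw = by-cases (w ≟ v) (w ≟ s)
      where
      by-cases : Dec (w ≡ v) → Dec (w ≡ s) → Matched w (p w)
      by-cases (yes refl) _ = subst (Matched v) (sym p-v) (Us , vs , p-s)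
      by-cases (no _) (yes refl) = subst (Matched s) (sym p-s) (Uv , adj-sym vs , p-v)
      by-cases (no w≢v) (no w≢s) with p′-matches w (into-∖N Uw w≢v w≢s)
      ... | in-∖N , w-pw , involutive with out-of-∖N in-∖N
      ...   | Upw , pw≢v , pw≢s = subst (Matched w) (sym (p-other w w≢v w≢s))
              (Upw , w-pw , trans (p-other (p′ w) pw≢v pw≢s) involutive)

module C4FreeWellCovered {n : ℕ} (G : Graph n) (c4 : C4Free G) where
  open Counting
  open Graph G using (adj; irrefl)
  open InducedStableSets G

  noInducedC4 : ∀ a b c d → a ≢ b → a ≢ c → a ≢ d → b ≢ c → b ≢ d → c ≢ d →
    adj a b ≡ true → adj b c ≡ true → adj c d ≡ true → adj d a ≡ true →
    adj a c ≡ false → adj b d ≡ false → ⊥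
  noInducedC4 a b c d ab ac ad bc bd cd e₁ e₂ e₃ e₄ f₁ f₂ =
    c4 a b c d ab ac ad bc bd cd e₁ e₂ e₃ e₄
       (λ t → true≢false (trans (sym t) f₁)) (λ t → true≢false (trans (sym t) f₂))

  FalseTwins : (Fin n → Bool) → Fin n → Fin n → Set
  FalseTwins U u v = u ≢ v × adj u v ≡ false × (∀ i → U i ≡ true → adj u i ≡ adj v i)

  -- the common neighbourhood of false twins u, v is a clique, since two
  -- non-adjacent common neighbours a, b would induce the 4-cycle v a u b
  twins-clique : ∀ U u v → FalseTwins U u v → ∀ a b → U a ≡ true → U b ≡ true →
    adj v a ≡ true → adj v b ≡ true → a ≢ b → adj a b ≡ true
  twins-clique U u v (u≢v , uv , same) a b Ua Ub va vb a≢b with adj a b in ab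
  ... | true = refl
  ... | false = ⊥-elim (noInducedC4 v a u b (adj⇒≢ va) (λ e → u≢v (sym e)) (adj⇒≢ vb)
                  (λ { refl → adj⇒≢ ua refl }) a≢b (λ { refl → adj⇒≢ ub refl })
                  va (adj-sym ua) ub (adj-sym vb) (adj-sym-false uv) ab)
    where
    ua = trans (same a Ua) va
    ub = trans (same b Ub) vb

  -- In a well-covered C4-free graph false twins have no common neighbour k:
  -- a maximal stable set T of G[U ∖ N[k]] gives the maximal stable set
  -- T + k of G[U], but T + u + v is stable as well and extends to a
  -- maximal stable set with at least |T| + 2 vertices.
  noFalseTwins : ∀ U → WellCoveredOn U → ∀ u v → U u ≡ true → U v ≡ true →
    FalseTwins U u v → ∀ k → U k ≡ true → adj v k ≡ true → ⊥
  noFalseTwins U wc u v Uu Uv twins@(u≢v , uv , same) k Uk vk = 1+n≰n (begin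
    suc (suc (count T))   ≡⟨ proj₂ (proj₂ T+u+v-facts) ⟨
    count T+u+v           ≤⟨ count-mono (proj₂ (proj₂ extension)) ⟩
    count B               ≡⟨ wc B (insert T k) maxB (maximal-insert U k T Uk maxT) ⟩
    count (insert T k)    ≡⟨ count-insert T k (∉-maximal-∖N U k T maxT) ⟩
    suc (count T)         ∎)
    where
    open ≤-Reasoning
    T : Fin n → Bool
    T = proj₁ (someMaximal (U ∖N[ k ]))
    maxT : MaximalStableIn (U ∖N[ k ]) T
    maxT = proj₂ (someMaximal (U ∖N[ k ]))
    T-in : ∀ {i} → T i ≡ true → U i ≡ true × i ≢ k × adj k i ≡ false
    T-in e = ∖N-el U k (proj₁ maxT _ e)
    ku : adj k u ≡ true
    ku = adj-sym (trans (same k Uk) vk)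
    -- no vertex of T is adjacent to v (or u): by the clique property it
    -- would be adjacent to k
    v-free : ∀ b → T b ≡ true → adj v b ≡ false
    v-free b Tb = ¬-not λ vb → let (Ub , b≢k , kb) = T-in Tb in
      true≢false (trans (sym (twins-clique U u v twins k b Uk Ub vk vb (λ e → b≢k (sym e)))) kb)
    u-free : ∀ b → T b ≡ true → adj u b ≡ false
    u-free b Tb = trans (same b (proj₁ (T-in Tb))) (v-free b Tb)
    Tu : T u ≡ false
    Tu = ¬-not λ Tu → true≢false (trans (sym ku) (proj₂ (proj₂ (T-in Tu))))
    Tv : T v ≡ false
    Tv = ¬-not λ Tv → true≢false (trans (sym (adj-sym vk)) (proj₂ (proj₂ (T-in Tv))))
    T+u+v : Fin n → Bool
    T+u+v = insert (insert T u) v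
    T+u+v-facts : T+u+v ⊑ U × IsStable T+u+v × count T+u+v ≡ suc (suc (count T))
    T+u+v-facts = stable-insert-pair U T u v (λ i Ti → proj₁ (T-in Ti)) (proj₁ (proj₂ maxT))
                    Uu Uv Tu Tv u≢v uv u-free v-free
    extension : Σ[ B ∈ (Fin n → Bool) ] (MaximalStableIn U B × T+u+v ⊑ B)
    extension = extendToMaximal U T+u+v (proj₁ T+u+v-facts) (proj₁ (proj₂ T+u+v-facts))
    B : Fin n → Bool
    B = proj₁ extension
    maxB : MaximalStableIn U B
    maxB = proj₁ (proj₂ extension)

  -- Deleting the closed neighbourhood of a vertex v of minimum degree from
  -- a well-covered C4-free graph without isolated vertices keeps both
  -- properties: a vertex w isolated in G[U ∖ N[v]] has N(w) ⊆ N(v), hence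
  -- N(w) = N(v) by minimality, and w, v would be false twins.
  module MinDegreeDeletion (U : Fin n → Bool) (wc : WellCoveredOn U) (ni : NoIsolatedOn U)
                           (v : Fin n) (Uv : U v ≡ true)
                           (minimum : ∀ u → U u ≡ true → degree U v ≤ degree U u) where
    U′ : Fin n → Bool
    U′ = U ∖N[ v ]

    wellCovered′ : WellCoveredOn U′
    wellCovered′ = wellCovered-∖N U v Uv wc

    noIsolated′ : NoIsolatedOn U′
    noIsolated′ w U′w with any? (λ u → (U′ u ≟ᵇ true) ×-dec (adj w u ≟ᵇ true))
    ... | yes (u , U′u , wu) = u , U′u , wu
    ... | no isolated with ∖N-el U v U′w | ni v Uv
    ...   | Uw , w≢v , vw | k , Uk , vk =
      ⊥-elim (noFalseTwins U wc w v Uw Uv (w≢v , adj-sym-false vw , same) k Uk vk)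
      where
      N-w⊑N-v : (λ i → U i ∧ adj w i) ⊑ (λ i → U i ∧ adj v i)
      N-w⊑N-v i e with ∧-true {U i} e
      ... | Ui , wi with U′ i in U′i
      ...   | true = ⊥-elim (isolated (i , U′i , wi))
      ...   | false with ∖N-out U v Ui U′i
      ...     | inj₂ vi = ∧-intro Ui vi
      ...     | inj₁ refl = ⊥-elim (true≢false (trans (sym (adj-sym wi)) vw))
      N-v⊑N-w : (λ i → U i ∧ adj v i) ⊑ (λ i → U i ∧ adj w i)
      N-v⊑N-w = count-⊑-reverse N-w⊑N-v (minimum w Uw)
      same : ∀ i → U i ≡ true → adj w i ≡ adj v i
      same i Ui = bool-ext (λ wi → proj₂ (∧-true {U i} (N-w⊑N-v i (∧-intro Ui wi))))
                           (λ vi → proj₂ (∧-true {U i} (N-v⊑N-w i (∧-intro Ui vi))))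

    degree≥1 : 1 ≤ degree U v
    degree≥1 = let (k , Uk , vk) = ni v Uv in count-≥1 k (∧-intro Uk vk)

    X′ : Fin n → Bool
    X′ = proj₁ (someMaximal U′)

    maxX′ : MaximalStableIn U′ X′
    maxX′ = proj₂ (someMaximal U′)

    count-maximal : ∀ X → MaximalStableIn U X → count X ≡ suc (count X′)
    count-maximal X maxX = trans (wc X (insert X′ v) maxX (maximal-insert U v X′ Uv maxX′))
                                 (count-insert X′ v (∉-maximal-∖N U v X′ maxX′))

  -- In a well-covered C4-free graph without isolated vertices every maximal
  -- stable set X satisfies 2 |X| ≤ |V|; induction on |U| by deleting the
  -- closed neighbourhood of a vertex of minimum degree, which loses one
  -- vertex of X and at least two vertices of U.
  twice-maximal≤ : ∀ k U → count U ≤ k → WellCoveredOn U → NoIsolatedOn U →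
    ∀ X → MaximalStableIn U X → 2 * count X ≤ count U
  twice-maximal≤ k U bound wc ni X maxX with emptyOrMinDegree U
  ... | inj₁ empty = subst (λ c → 2 * c ≤ count U)
          (sym (count-empty λ i → ¬-not λ Xi → true≢false (trans (sym (proj₁ maxX i Xi)) (empty i)))) z≤n
  twice-maximal≤ zero U bound wc ni X maxX | inj₂ (v , Uv , _) =
    ⊥-elim (1+n≰n (≤-trans (count-≥1 v Uv) bound))
  twice-maximal≤ (suc k) U bound wc ni X maxX | inj₂ (v , Uv , minimum) = begin
    2 * count X                   ≡⟨ cong (2 *_) (count-maximal X maxX) ⟩
    2 * suc (count X′)            ≡⟨ *-suc 2 (count X′) ⟩
    2 + 2 * count X′              ≤⟨ s≤s (+-mono-≤ degree≥1 induction) ⟩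
    suc (degree U v + count U′)   ≡⟨ count-∖N U v Uv ⟨
    count U                       ∎
    where
    open MinDegreeDeletion U wc ni v Uv minimum
    open ≤-Reasoning
    bound′ : count U′ ≤ k
    bound′ = ≤-pred (≤-trans (s≤s (m≤n+m (count U′) (degree U v))) (subst (_≤ suc k) (count-∖N U v Uv) bound))
    induction : 2 * count X′ ≤ count U′
    induction = twice-maximal≤ k U′ bound′ wellCovered′ noIsolated′ X′ maxX′

  VeryWellCoveredOn : (Fin n → Bool) → Set
  VeryWellCoveredOn U =
    WellCoveredOn U × NoIsolatedOn U × (∀ X → MaximalStableIn U X → count U ≡ 2 * count X)

  -- In a very well-covered C4-free G[U] a vertex v of minimum degree is
  -- pendant (equality in 2 |X| ≤ |U| leaves no room for a second
  -- neighbour), and deleting v together with its neighbour s leaves a very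
  -- well-covered graph.
  module PendantDeletion (U : Fin n → Bool) (vwc : VeryWellCoveredOn U)
                         (v : Fin n) (Uv : U v ≡ true)
                         (minimum : ∀ u → U u ≡ true → degree U v ≤ degree U u) where
    wc : WellCoveredOn U
    wc = proj₁ vwc

    ni : NoIsolatedOn U
    ni = proj₁ (proj₂ vwc)

    order≡2α : ∀ X → MaximalStableIn U X → count U ≡ 2 * count X
    order≡2α = proj₂ (proj₂ vwc)

    open MinDegreeDeletion U wc ni v Uv minimum public

    s : Fin n
    s = proj₁ (ni v Uv)

    Us : U s ≡ true
    Us = proj₁ (proj₂ (ni v Uv))

    vs : adj v s ≡ true
    vs = proj₂ (proj₂ (ni v Uv))

    count-U : count U ≡ 2 * suc (count X′)
    count-U = trans (order≡2α (insert X′ v) (maximal-insert U v X′ Uv maxX′))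
                    (cong (2 *_) (count-insert X′ v (∉-maximal-∖N U v X′ maxX′)))

    degree≤1 : degree U v ≤ 1
    degree≤1 = +-cancelʳ-≤ (count U′) (degree U v) 1 (≤-pred (begin
      suc (degree U v + count U′)   ≡⟨ count-∖N U v Uv ⟨
      count U                       ≡⟨ count-U ⟩
      2 * suc (count X′)            ≡⟨ *-suc 2 (count X′) ⟩
      2 + 2 * count X′              ≤⟨ +-monoʳ-≤ 2 (twice-maximal≤ _ U′ ≤-refl wellCovered′ noIsolated′ X′ maxX′) ⟩
      2 + count U′                  ∎))
      where open ≤-Reasoning

    unique : ∀ i → U i ≡ true → adj v i ≡ true → i ≡ s
    unique i Ui vi = decidable-stable (i ≟ s) λ i≢s →
      1+n≰n (≤-trans (count-two i s (∧-intro Ui vi) (∧-intro Us vs) i≢s) degree≤1)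

    count-U′ : count U ≡ 2 + count U′
    count-U′ = trans (count-∖N U v Uv) (cong (λ d → suc (d + count U′)) (≤-antisym degree≤1 degree≥1))

    veryWellCovered′ : VeryWellCoveredOn U′
    veryWellCovered′ = wellCovered′ , noIsolated′ , size′
      where
      size′ : ∀ X → MaximalStableIn U′ X → count U′ ≡ 2 * count X
      size′ X maxX = +-cancelˡ-≡ 2 (count U′) (2 * count X) (begin
        2 + count U′             ≡⟨ count-U′ ⟨
        count U                  ≡⟨ order≡2α (insert X v) (maximal-insert U v X Uv maxX) ⟩
        2 * count (insert X v)   ≡⟨ cong (2 *_) (count-insert X v (∉-maximal-∖N U v X maxX)) ⟩
        2 * suc (count X)        ≡⟨ *-suc 2 (count X) ⟩
        2 + 2 * count X          ∎)
        where open ≡-Reasoning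

  -- a very well-covered C4-free graph has a perfect matching, obtained by
  -- repeatedly matching a pendant vertex of minimum degree to its neighbour
  perfectMatching : ∀ k U → count U ≤ k → VeryWellCoveredOn U → PerfectMatchingOn U
  perfectMatching k U bound vwc with emptyOrMinDegree U
  ... | inj₁ empty = (λ i → i) , λ v Uv → ⊥-elim (true≢false (trans (sym Uv) (empty v)))
  perfectMatching zero U bound vwc | inj₂ (v , Uv , _) =
    ⊥-elim (1+n≰n (≤-trans (count-≥1 v Uv) bound))
  perfectMatching (suc k) U bound vwc | inj₂ (v , Uv , minimum) =
    extend-matching U v s Uv Us vs unique (perfectMatching k U′ bound′ veryWellCovered′)
    where
    open PendantDeletion U vwc v Uv minimum
    bound′ : count U′ ≤ k
    bound′ = ≤-pred (≤-trans (n≤1+n _) (subst (_≤ suc k) count-U′ bound))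

module VeryWellCoveredC4Free {n : ℕ} (G : Graph n) (c4 : C4Free G) (vwc : VeryWellCovered G) where
  open Counting
  open SubsetsAsFunctions
  open Graph G using (adj; irrefl)
  open InducedStableSets G
  open C4FreeWellCovered G c4

  stable⇒IsStable : ∀ (S : Subset n) → Stable G S → IsStable (lookup S)
  stable⇒IsStable S st a b Sa Sb = ¬-not (st a b (true⇒∈ S Sa) (true⇒∈ S Sb))

  IsStable⇒stable : ∀ X → IsStable X → Stable G (fromFunction X)
  IsStable⇒stable X st a b a∈ b∈ ab = true≢false (trans (sym ab) (st a b (in-X a∈) (in-X b∈)))
    where
    in-X : ∀ {i} → i ∈ₛ fromFunction X → X i ≡ true
    in-X {i} i∈ = trans (sym (lookup-fromFunction X i)) (∈⇒true _ i∈)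

  maximal⇒MaximalStable : ∀ X → MaximalStableIn full X → MaximalStable G (fromFunction X)
  maximal⇒MaximalStable X (_ , st , dom) = IsStable⇒stable X st , λ T stT X⊆T {t} t∈T →
    true⇒∈ (fromFunction X) (trans (lookup-fromFunction X t) (in-X T stT X⊆T t t∈T))
    where
    in-X : ∀ T → Stable G T → fromFunction X ⊆ₛ T → ∀ t → t ∈ₛ T → X t ≡ true
    in-X T stT X⊆T t t∈T with X t in Xt
    ... | true = refl
    ... | false with dom t refl Xt
    ...   | u , Xu , tu = ⊥-elim (stT t u t∈T (X⊆T (true⇒∈ _ (trans (lookup-fromFunction X u) Xu))) tu)

  wellCovered : WellCoveredOn full
  wellCovered X Y maxX maxY = begin
    count X                     ≡⟨ ∣fromFunction∣ X ⟨
    ∣ fromFunction X ∣        ≡⟨ proj₁ vwc _ _ (maximal⇒MaximalStable X maxX) (maximal⇒MaximalStable Y maxY) ⟩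
    ∣ fromFunction Y ∣        ≡⟨ ∣fromFunction∣ Y ⟩
    count Y                     ∎
    where open ≡-Reasoning

  maximal⇒MaximumStable : ∀ X → MaximalStableIn full X → MaximumStable G (fromFunction X)
  maximal⇒MaximumStable X maxX = IsStable⇒stable X (proj₁ (proj₂ maxX)) , λ T stT →
    let (Y , maxY , T⊑Y) = extendToMaximal full (lookup T) (λ _ _ → refl) (stable⇒IsStable T stT)
    in begin
      ∣ T ∣                ≡⟨ ∣∣≡count T ⟩
      count (lookup T)       ≤⟨ count-mono T⊑Y ⟩
      count Y                ≡⟨ wellCovered Y X maxY maxX ⟩
      count X                ≡⟨ ∣fromFunction∣ X ⟨
      ∣ fromFunction X ∣   ∎
    where open ≤-Reasoning

  veryWellCovered : VeryWellCoveredOn full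
  veryWellCovered = wellCovered , (λ v _ → let (u , vu) = proj₁ (proj₂ vwc) v in u , refl , vu) ,
    λ X maxX → begin
      count (full {n})        ≡⟨ count-full ⟩
      n                       ≡⟨ proj₂ (proj₂ vwc) _ (maximal⇒MaximumStable X maxX) ⟩
      2 * ∣ fromFunction X ∣ ≡⟨ cong (2 *_) (∣fromFunction∣ X) ⟩
      2 * count X             ∎
    where open ≡-Reasoning

  perfect : PerfectMatchingOn full
  perfect = perfectMatching n full (count≤n {n} full) veryWellCovered

  -- the perfect matching of G, as the involution v ↦ mate v; kept abstract
  -- so that the type checker never unfolds its construction
  abstract
    mate : Fin n → Fin n
    mate = proj₁ perfect

    mate-adj : ∀ v → adj v (mate v) ≡ true
    mate-adj v = proj₁ (proj₂ (proj₂ perfect v refl))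

    mate-involutive : ∀ v → mate (mate v) ≡ v
    mate-involutive v = proj₂ (proj₂ (proj₂ perfect v refl))

  mate-injective : ∀ {a b} → mate a ≡ mate b → a ≡ b
  mate-injective {a} {b} e = trans (sym (mate-involutive a)) (trans (cong mate e) (mate-involutive b))

  mate≢ : ∀ v → v ≢ mate v
  mate≢ v = adj⇒≢ (mate-adj v)

  mate-disjoint : ∀ T → IsStable T → ∀ i → T i ≡ true → T (mate i) ≡ false
  mate-disjoint T st i Ti = ¬-not λ Tmi → true≢false (trans (sym (mate-adj i)) (st i (mate i) Ti Tmi))

  -- Favaron's property of the perfect matching: no stable set meets both
  -- N(x) and N(mate x).  Otherwise extend it to a maximal stable set T;
  -- T avoids x and mate x, and T, mate[T] are disjoint, so
  -- n = 2 |T| ≤ |V ∖ {x, mate x}| = n - 2.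
  noStableAcross : ∀ x A → IsStable A → ∀ a b → A a ≡ true → A b ≡ true →
    adj x a ≡ true → adj (mate x) b ≡ true → ⊥
  noStableAcross x A st a b Aa Ab xa yb = 1+n≰n (begin
    suc (suc (count R))              ≡⟨ count-V ⟨
    count (full {n})                 ≡⟨ proj₂ (proj₂ veryWellCovered) T maxT ⟩
    2 * count T                      ≡⟨ cong (count T +_) (+-identityʳ (count T)) ⟩
    count T + count T                ≤⟨ +-monoʳ-≤ (count T) count-T≤count-mateT ⟩
    count T + count (λ i → T (mate i)) ≡⟨ count-∪ T (λ i → T (mate i)) (mate-disjoint T stT) ⟨
    count (λ i → T i ∨ T (mate i))   ≤⟨ count-mono T∪mateT⊑R ⟩
    count R                          ≤⟨ n≤1+n (count R) ⟩
    suc (count R)                    ∎)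
    where
    open ≤-Reasoning
    extension : Σ[ T ∈ (Fin n → Bool) ] (MaximalStableIn full T × A ⊑ T)
    extension = extendToMaximal full A (λ _ _ → refl) st
    T : Fin n → Bool
    T = proj₁ extension
    maxT : MaximalStableIn full T
    maxT = proj₁ (proj₂ extension)
    stT : IsStable T
    stT = proj₁ (proj₂ maxT)
    ∉T : ∀ {i j} → adj i j ≡ true → T j ≡ true → T i ≡ false
    ∉T ij Tj = ¬-not λ Ti → true≢false (trans (sym ij) (stT _ _ Ti Tj))
    Tx : T x ≡ false
    Tx = ∉T xa (proj₂ (proj₂ extension) a Aa)
    Tmx : T (mate x) ≡ false
    Tmx = ∉T yb (proj₂ (proj₂ extension) b Ab)
    R : Fin n → Bool
    R = delete (delete full x) (mate x)
    count-V : count (full {n}) ≡ suc (suc (count R))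
    count-V = trans (count-delete full x refl)
      (cong suc (count-delete (delete full x) (mate x) (delete-intro full x refl (λ e → mate≢ x (sym e)))))
    count-T≤count-mateT : count T ≤ count (λ i → T (mate i))
    count-T≤count-mateT = count-injection mate
      (λ i Ti → subst (λ j → T j ≡ true) (sym (mate-involutive i)) Ti)
      (λ i j _ _ → mate-injective)
    T∪mateT⊑R : (λ i → T i ∨ T (mate i)) ⊑ R
    T∪mateT⊑R i e = delete-intro (delete full x) (mate x) (delete-intro full x refl i≢x) i≢mx
      where
      i≢x : i ≢ x
      i≢x refl with ∨-true {T i} e
      ... | inj₁ Ti = true≢false (trans (sym Ti) Tx)
      ... | inj₂ Tmi = true≢false (trans (sym Tmi) Tmx)
      i≢mx : i ≢ mate x
      i≢mx refl with ∨-true {T (mate x)} e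
      ... | inj₁ Ti = true≢false (trans (sym Ti) Tmx)
      ... | inj₂ Tmi = true≢false (trans (sym Tmi) (trans (cong T (mate-involutive x)) Tx))

  Pendant : Fin n → Set
  Pendant x = ∀ u → adj x u ≡ true → u ≡ mate x

  pendant? : ∀ x → Dec (Pendant x)
  pendant? x = all? (λ u → (adj x u ≟ᵇ true) →-dec (u ≟ mate x))

  otherNeighbour : ∀ x → ¬ Pendant x → ∃[ a ] (adj x a ≡ true × a ≢ mate x)
  otherNeighbour x ¬pendant with ¬∀⟶∃¬ n _ (λ u → (adj x u ≟ᵇ true) →-dec (u ≟ mate x)) ¬pendant
  ... | a , ¬a with adj x a in xa | a ≟ mate x
  ...   | true | no a≢mx = a , xa , a≢mx
  ...   | true | yes a≡mx = ⊥-elim (¬a (λ _ → a≡mx))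
  ...   | false | _ = ⊥-elim (¬a (λ ()))

  -- every edge of the perfect matching has a pendant end: other neighbours
  -- a of x and b of mate x would give a stable set {a}, {b} or {a, b}
  -- across the edge, or an induced 4-cycle x a b (mate x)
  pendantEnd : ∀ x → Pendant x ⊎ Pendant (mate x)
  pendantEnd x with pendant? x | pendant? (mate x)
  ... | yes px | _ = inj₁ px
  ... | no _ | yes pmx = inj₂ pmx
  ... | no ¬px | no ¬pmx with otherNeighbour x ¬px | otherNeighbour (mate x) ¬pmx
  ...   | a , xa , a≢mx | b , mxb , b≢mmx = ⊥-elim (across (adj a (mate x)) (adj x b) refl refl)
    where
    b≢x : b ≢ x
    b≢x e = b≢mmx (trans e (sym (mate-involutive x)))
    singleton-stable : ∀ c → IsStable (insert ∅ c)
    singleton-stable c = stable-insert ∅ c (λ _ _ ()) (λ _ ())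
    across : ∀ α β → adj a (mate x) ≡ α → adj x b ≡ β → ⊥
    across true _ amx _ = noStableAcross x (insert ∅ a) (singleton-stable a) a a
      (insert-here ∅ a) (insert-here ∅ a) xa (adj-sym amx)
    across false true _ xb = noStableAcross x (insert ∅ b) (singleton-stable b) b b
      (insert-here ∅ b) (insert-here ∅ b) xb mxb
    across false false amx xb with a ≟ b | adj a b in ab
    ... | yes refl | _ = true≢false (trans (sym (adj-sym mxb)) amx)
    ... | no a≢b | true = noInducedC4 x a b (mate x) (adj⇒≢ xa) (λ e → b≢x (sym e)) (mate≢ x) a≢b a≢mx
                            (λ e → adj⇒≢ mxb (sym e)) xa ab (adj-sym mxb) (adj-sym (mate-adj x)) xb amx
    ... | no _ | false = noStableAcross x (insert (insert ∅ a) b) pair-stable a b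
                           (insert-old (insert ∅ a) b a (insert-here ∅ a)) (insert-here (insert ∅ a) b) xa mxb
      where
      pair-stable : IsStable (insert (insert ∅ a) b)
      pair-stable = stable-insert (insert ∅ a) b (singleton-stable a) b-free
        where
        b-free : ∀ c → insert ∅ a c ≡ true → adj b c ≡ false
        b-free c e with insert-el ∅ a c e
        ... | inj₂ refl = adj-sym-false ab

  -- Counting the edges of a matching M: every edge {u, v} is listed once,
  -- as (u, v) with u < v, so 2 |M| = Σ_u deg_M(u) ≤ n (handshake lemma).
  module EdgeCount (M : Matching G) where
    open Matching M using (edge; edge-sym; edge-adj; disjoint)

    listed : Fin n → Fin n → ℕ
    listed u v = bit (does (toℕ u <? toℕ v) ∧ edge u v)

    size≡ : size G M ≡ sum (λ u → sum (listed u))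
    size≡ = trans (length-filter-pairs listed?)
      (sum-cong-≗ λ u → sum-cong-≗ λ v → cong (λ b → bit (does (toℕ u <? toℕ v) ∧ b)) (does-≟true (edge u v)))
      where
      listed? : ∀ (p : Fin n × Fin n) → Dec (toℕ (proj₁ p) < toℕ (proj₂ p) × edge (proj₁ p) (proj₂ p) ≡ true)
      listed? = λ p → (toℕ (proj₁ p) <? toℕ (proj₂ p)) ×-dec (edge (proj₁ p) (proj₂ p) ≟ᵇ true)
      does-≟true : ∀ b → does (b ≟ᵇ true) ≡ b
      does-≟true true = refl
      does-≟true false = refl

    edge-irrefl : ∀ u → edge u u ≡ false
    edge-irrefl u = ¬-not λ uu → adj⇒≢ (edge-adj u u uu) refl

    listed-once : ∀ u v → listed u v + listed v u ≡ bit (edge u v)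
    listed-once u v with <-cmp (toℕ u) (toℕ v)
    ... | tri< u<v _ v≮u rewrite dec-true (toℕ u <? toℕ v) u<v | dec-false (toℕ v <? toℕ u) v≮u =
          +-identityʳ _
    ... | tri≈ u≮v u≡v _ rewrite toℕ-injective u≡v | dec-false (toℕ v <? toℕ v) (<-irrefl refl)
                               | edge-irrefl v = refl
    ... | tri> u≮v _ v<u rewrite dec-false (toℕ u <? toℕ v) u≮v | dec-true (toℕ v <? toℕ u) v<u
                               | edge-sym u v = refl

    handshake : 2 * size G M ≡ sum (λ u → count (edge u))
    handshake = begin
      2 * size G M                                          ≡⟨ cong (size G M +_) (+-identityʳ _) ⟩
      size G M + size G M                                   ≡⟨ cong₂ _+_ size≡ (trans size≡ (∑-comm listed)) ⟩
      sum (λ u → sum (listed u)) + sum (λ u → sum (λ v → listed v u))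
                                                            ≡⟨ ∑-distrib-+ (λ u → sum (listed u)) _ ⟨
      sum (λ u → sum (listed u) + sum (λ v → listed v u))   ≡⟨ sum-cong-≗ (λ u → ∑-distrib-+ (listed u) _) ⟨
      sum (λ u → sum (λ v → listed u v + listed v u))       ≡⟨ sum-cong-≗ (λ u → sum-cong-≗ (listed-once u)) ⟩
      sum (λ u → count (edge u))                            ∎
      where open ≡-Reasoning

    degree≤1 : ∀ u → count (edge u) ≤ 1
    degree≤1 u = count-≤1 (disjoint u)

    twice-size≤n : 2 * size G M ≤ n
    twice-size≤n = subst (_≤ n) (sym handshake) (sum≤n degree≤1)

  mateMatching : Matching G
  mateMatching = record
    { edge = λ u v → v ≐ mate u
    ; edge-sym = λ u v → bool-ext (λ e → ≡⇒≐ (mate-swap {u} {v} (≐-true e)))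
                                  (λ e → ≡⇒≐ (mate-swap {v} {u} (≐-true e)))
    ; edge-adj = λ u v e → subst (λ w → adj u w ≡ true) (sym (≐-true e)) (mate-adj u)
    ; disjoint = λ u v w e₁ e₂ → trans (≐-true e₁) (sym (≐-true e₂))
    }
    where
    ≡⇒≐ : ∀ {i j} → i ≡ j → (i ≐ j) ≡ true
    ≡⇒≐ {i} refl = ≐-refl i
    mate-swap : ∀ {u v} → v ≡ mate u → u ≡ mate v
    mate-swap {u} refl = sym (mate-involutive u)

  twice-size-mateMatching : 2 * size G mateMatching ≡ n
  twice-size-mateMatching = begin
    2 * size G mateMatching                ≡⟨ EdgeCount.handshake mateMatching ⟩
    sum (λ u → count (λ v → v ≐ mate u))   ≡⟨ sum-cong-≗ (λ u → count-singleton (mate u)) ⟩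
    count (full {n})                       ≡⟨ count-full ⟩
    n                                      ∎
    where open ≡-Reasoning

  mateMatching-maximum : MaximumMatching G mateMatching
  mateMatching-maximum M′ = *-cancelˡ-≤ 2
    (subst (2 * size G M′ ≤_) (sym twice-size-mateMatching) (EdgeCount.twice-size≤n M′))

  -- a maximum matching covers every vertex, since 2 |M′| = n
  maximum-covers : ∀ M′ → MaximumMatching G M′ → ∀ u → ∃[ v ] Matching.edge M′ u v ≡ true
  maximum-covers M′ maximum u =
    count-nonempty (subst (0 <_) (sym (sum≥n⇒all-one (EdgeCount.degree≤1 M′) covers u)) (s≤s z≤n))
    where
    covers : n ≤ sum (λ u → count (Matching.edge M′ u))
    covers = subst₂ _≤_ twice-size-mateMatching (EdgeCount.handshake M′) (*-monoʳ-≤ 2 (maximum mateMatching))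

  -- the pendant end of the edge {u, mate u} forces any maximum matching
  -- to match u with mate u
  maximum-contains-mate : ∀ M′ → MaximumMatching G M′ → ∀ u → Matching.edge M′ u (mate u) ≡ true
  maximum-contains-mate M′ maximum u with pendantEnd u
  ... | inj₁ u-pendant =
        let (w , uw) = maximum-covers M′ maximum u
        in subst (λ z → edge u z ≡ true) (u-pendant w (edge-adj u w uw)) uw
    where open Matching M′ using (edge; edge-adj)
  ... | inj₂ mu-pendant =
        let (w , muw) = maximum-covers M′ maximum (mate u)
        in trans (edge-sym u (mate u))
             (subst (λ z → edge (mate u) z ≡ true)
                    (trans (mu-pendant w (edge-adj (mate u) w muw)) (mate-involutive u)) muw)
    where open Matching M′ using (edge; edge-sym; edge-adj)

  uniqueMaximumMatching : UniqueMaximumMatching G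
  uniqueMaximumMatching = mateMatching , mateMatching-maximum , λ M′ maximum u v →
    bool-ext (λ e → subst (λ z → Matching.edge M′ u z ≡ true) (sym (≐-true e)) (maximum-contains-mate M′ maximum u))
             (λ e → subst (λ z → (z ≐ mate u) ≡ true)
                          (Matching.disjoint M′ u (mate u) v (maximum-contains-mate M′ maximum u) e) (≐-refl (mate u)))

  MateClosed : (Fin n → Bool) → Set
  MateClosed X = ∀ s w → X s ≡ true → adj s w ≡ true → X (mate w) ≡ true

  stable-not-mates : ∀ T → IsStable T → ∀ i j → T i ≡ true → T j ≡ true → i ≢ mate j
  stable-not-mates T stT i j Ti Tj refl = true≢false (trans (sym (mate-adj j)) (stT j (mate j) Tj Ti))

  -- If every vertex of a stable set T lies in Y or has its mate in Y, then
  -- |T| ≤ |Y|: send t to t or to mate t, whichever lies in Y.  This is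
  -- injective on T, as two vertices of T are never mates of each other.
  count-≤-via-mate : ∀ T Y → IsStable T → (∀ t → T t ≡ true → Y t ≡ true ⊎ Y (mate t) ≡ true) →
    count T ≤ count Y
  count-≤-via-mate T Y stT covered = count-injection h into injective
    where
    h : Fin n → Fin n
    h t = if Y t then t else mate t
    into : ∀ t → T t ≡ true → Y (h t) ≡ true
    into t Tt with Y t in Yt | covered t Tt
    ... | true | _ = Yt
    ... | false | inj₂ Ymt = Ymt
    ... | false | inj₁ ()
    injective : ∀ i j → T i ≡ true → T j ≡ true → h i ≡ h j → i ≡ j
    injective i j Ti Tj e with Y i | Y j
    ... | true | true = e
    ... | true | false = ⊥-elim (stable-not-mates T stT i j Ti Tj e)
    ... | false | true = ⊥-elim (stable-not-mates T stT j i Tj Ti (sym e))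
    ... | false | false = mate-injective e

  -- a stable mate-closed set is a local maximum stable set: every stable
  -- set inside N[S] lies in S or has its mates in S
  closed⇒Ψ : ∀ S → IsStable (lookup S) → MateClosed (lookup S) → Ψ G S
  closed⇒Ψ S stS closed =
    (λ a b a∈S b∈S ab → true≢false (trans (sym ab) (stS a b (∈⇒true S a∈S) (∈⇒true S b∈S)))) ,
    λ T stT T⊆N[S] → begin
      ∣ T ∣             ≡⟨ ∣∣≡count T ⟩
      count (lookup T)    ≤⟨ count-≤-via-mate (lookup T) (lookup S) (stable⇒IsStable T stT) (covered T T⊆N[S]) ⟩
      count (lookup S)    ≡⟨ ∣∣≡count S ⟨
      ∣ S ∣             ∎
    where
    open ≤-Reasoning
    covered : ∀ T → (∀ v → v ∈ₛ T → InClosedNbhd G S v) →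
      ∀ t → lookup T t ≡ true → lookup S t ≡ true ⊎ lookup S (mate t) ≡ true
    covered T T⊆N[S] t Tt with T⊆N[S] t (true⇒∈ T Tt)
    ... | inj₁ t∈S = inj₁ (∈⇒true S t∈S)
    ... | inj₂ (s , s∈S , st) = inj₂ (closed s t (∈⇒true S s∈S) st)

  OnEdge : Fin n → Fin n → Set
  OnEdge t c = c ≡ t ⊎ c ≡ mate t

  stable-sameEdge : ∀ X → IsStable X → ∀ t₁ t₂ c → X t₁ ≡ true → X t₂ ≡ true →
    OnEdge t₁ c → OnEdge t₂ c → t₁ ≡ t₂
  stable-sameEdge X st t₁ t₂ c X₁ X₂ (inj₁ refl) (inj₁ refl) = refl
  stable-sameEdge X st t₁ t₂ c X₁ X₂ (inj₁ refl) (inj₂ c≡m₂) =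
    ⊥-elim (stable-not-mates X st t₁ t₂ X₁ X₂ c≡m₂)
  stable-sameEdge X st t₁ t₂ c X₁ X₂ (inj₂ refl) (inj₁ c≡t₂) =
    ⊥-elim (stable-not-mates X st t₂ t₁ X₂ X₁ (sym c≡t₂))
  stable-sameEdge X st t₁ t₂ c X₁ X₂ (inj₂ refl) (inj₂ c≡m₂) = mate-injective c≡m₂

  pendantOf : Fin n → Fin n
  pendantOf t = [ (λ _ → t) , (λ _ → mate t) ]′ (pendantEnd t)

  pendantOf-pendant : ∀ t → Pendant (pendantOf t)
  pendantOf-pendant t with pendantEnd t
  ... | inj₁ t-pendant = t-pendant
  ... | inj₂ mt-pendant = mt-pendant

  pendantOf-onEdge : ∀ t → OnEdge t (pendantOf t)
  pendantOf-onEdge t with pendantEnd t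
  ... | inj₁ _ = inj₁ refl
  ... | inj₂ _ = inj₂ refl

  mate-onEdge : ∀ {t c} → OnEdge t c → OnEdge t (mate c)
  mate-onEdge {t} (inj₁ refl) = inj₂ refl
  mate-onEdge {t} (inj₂ refl) = inj₁ (mate-involutive t)

  pendantEnds : (Fin n → Bool) → Fin n → Bool
  pendantEnds X = image X pendantOf

  pendantEnds-nbr : ∀ X {c w} → pendantEnds X c ≡ true → adj w c ≡ true →
    ∃[ t ] (X t ≡ true × pendantOf t ≡ c × OnEdge t w)
  pendantEnds-nbr X {c} {w} Xc wc with image-el X pendantOf Xc
  ... | t , Xt , refl = t , Xt , refl , subst (OnEdge t) (sym (pendantOf-pendant t w (adj-sym wc)))
                                       (mate-onEdge (pendantOf-onEdge t))

  pendantEnds-stable : ∀ X → IsStable X → IsStable (pendantEnds X)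
  pendantEnds-stable X st a b Xa Xb with image-el X pendantOf Xb
  ... | t₂ , X₂ , refl = ¬-not λ ab → let (t₁ , X₁ , end₁ , on₁) = pendantEnds-nbr X Xa (adj-sym ab) in
    adj⇒≢ ab (trans (sym end₁) (cong pendantOf (stable-sameEdge X st t₁ t₂ _ X₁ X₂ on₁ (pendantOf-onEdge t₂))))

  pendantEnds-count : ∀ X → IsStable X → count X ≤ count (pendantEnds X)
  pendantEnds-count X st = count-image X pendantOf λ i j Xi Xj e →
    stable-sameEdge X st i j (pendantOf j) Xi Xj (subst (OnEdge i) e (pendantOf-onEdge i)) (pendantOf-onEdge j)

  -- Conversely, a local maximum stable set S is mate-closed.  Otherwise
  -- some s ∈ S has a neighbour w with mate w ∉ S.  The pendant ends L of
  -- the matching edges through S form a stable set in N[S] with |L| ≥ |S|,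
  -- and L + w is still stable, contradicting maximality of S in N[S].
  Ψ⇒closed : ∀ S → Ψ G S → MateClosed (lookup S)
  Ψ⇒closed S (st , bound) s w Ss sw with lookup S (mate w) in Smw
  ... | true = refl
  ... | false = ⊥-elim (1+n≰n (begin
      suc (count X)                    ≤⟨ s≤s (pendantEnds-count X stX) ⟩
      suc (count L)                    ≡⟨ count-insert L w w∉L ⟨
      count (insert L w)               ≡⟨ ∣fromFunction∣ (insert L w) ⟨
      ∣ fromFunction (insert L w) ∣  ≤⟨ bound _ (IsStable⇒stable (insert L w) L+w-stable) L+w⊆N[S] ⟩
      ∣ S ∣                          ≡⟨ ∣∣≡count S ⟩
      count X                          ∎))
    where
    open ≤-Reasoning
    X : Fin n → Bool
    X = lookup S
    stX : IsStable X
    stX = stable⇒IsStable S st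
    L : Fin n → Bool
    L = pendantEnds X
    w-off : ∀ t → X t ≡ true → OnEdge t w → ⊥
    w-off t Xt (inj₁ refl) = true≢false (trans (sym sw) (stX s t Ss Xt))
    w-off t Xt (inj₂ refl) = true≢false (trans (sym (subst (λ z → X z ≡ true) (sym (mate-involutive t)) Xt)) Smw)
    w∉L : L w ≡ false
    w∉L = ¬-not λ Lw → let (t , Xt , e) = image-el X pendantOf Lw in
      w-off t Xt (subst (OnEdge t) e (pendantOf-onEdge t))
    L+w-stable : IsStable (insert L w)
    L+w-stable = stable-insert L w (pendantEnds-stable X stX) λ b Lb → ¬-not λ wb →
      let (t , Xt , _ , on) = pendantEnds-nbr X Lb wb in w-off t Xt on
    L+w⊆N[S] : ∀ v → v ∈ₛ fromFunction (insert L w) → InClosedNbhd G S v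
    L+w⊆N[S] v v∈ with insert-el L w v (trans (sym (lookup-fromFunction (insert L w) v)) (∈⇒true _ v∈))
    ... | inj₂ refl = inj₂ (s , true⇒∈ S Ss , sw)
    ... | inj₁ Lv with image-el X pendantOf Lv
    ...   | t , Xt , e with pendantOf-onEdge t
    ...     | inj₁ p≡t = inj₁ (true⇒∈ S (subst (λ z → X z ≡ true) (trans (sym p≡t) e) Xt))
    ...     | inj₂ p≡mt = inj₂ (t , true⇒∈ S Xt , subst (λ z → adj t z ≡ true) (trans (sym p≡mt) e) (mate-adj t))

  Ψ-from : ∀ S X → (∀ i → lookup S i ≡ X i) → IsStable X → MateClosed X → Ψ G S
  Ψ-from S X same st closed = closed⇒Ψ S
    (λ a b Sa Sb → st a b (trans (sym (same a)) Sa) (trans (sym (same b)) Sb))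
    (λ s w Ss sw → trans (same (mate w)) (closed s w (trans (sym (same s)) Ss) sw))

  Ψ⇒stable : ∀ S → Ψ G S → IsStable (lookup S)
  Ψ⇒stable S ψ = stable⇒IsStable S (proj₁ ψ)

  Removable : (Fin n → Bool) → Fin n → Set
  Removable X x = X x ≡ true × (∀ s → X s ≡ true → adj s (mate x) ≡ true → s ≡ x)

  delete-closed : ∀ X x → MateClosed X → Removable X x → MateClosed (delete X x)
  delete-closed X x closed (_ , only-x) s w Ds sw with delete-el X x Ds
  ... | Xs , s≢x = delete-intro X x (closed s w Xs sw) λ mw≡x →
        s≢x (only-x s Xs (subst (λ z → adj s z ≡ true) (trans (sym (mate-involutive w)) (cong mate mw≡x)) sw))

  pendant-mate⇒removable : ∀ X x → X x ≡ true → Pendant (mate x) → Removable X x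
  pendant-mate⇒removable X x Xx pendant = Xx , λ s _ s-mx →
    trans (pendant s (adj-sym s-mx)) (mate-involutive x)

  removable-exists : ∀ X → ∀ x₀ → X x₀ ≡ true → ∃[ x ] Removable X x
  removable-exists X x₀ Xx₀ with pendantEnd x₀
  ... | inj₂ mx₀-pendant = x₀ , pendant-mate⇒removable X x₀ Xx₀ mx₀-pendant
  ... | inj₁ x₀-pendant with any? (λ w → (X w ≟ᵇ true) ×-dec (¬? (w ≟ x₀)) ×-dec (adj w (mate x₀) ≟ᵇ true))
  ...   | no none = x₀ , Xx₀ , λ s Xs s-mx₀ →
            decidable-stable (s ≟ x₀) λ s≢x₀ → none (s , Xs , s≢x₀ , s-mx₀)
  ...   | yes (w , Xw , w≢x₀ , w-mx₀) with pendantEnd w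
  ...     | inj₁ w-pendant = ⊥-elim (w≢x₀ (sym (mate-injective (w-pendant (mate x₀) w-mx₀))))
  ...     | inj₂ mw-pendant = w , pendant-mate⇒removable X w Xw mw-pendant

  accessible : ∀ S → Ψ G S → Nonempty S → ∃[ x ] (x ∈ₛ S × Ψ G (S -ₛ x))
  accessible S ψ (x₀ , x₀∈S) with removable-exists (lookup S) x₀ (∈⇒true S x₀∈S)
  ... | x , removable@(Sx , _) = x , true⇒∈ S Sx ,
        Ψ-from (S -ₛ x) (delete (lookup S) x) (lookup-- S x)
          (λ a b Da Db → Ψ⇒stable S ψ a b (proj₁ (delete-el (lookup S) x Da)) (proj₁ (delete-el (lookup S) x Db)))
          (delete-closed (lookup S) x (Ψ⇒closed S ψ) removable)

  Addable : (Fin n → Bool) → Fin n → Set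
  Addable Y x = Y x ≡ false × Y (mate x) ≡ false ×
    (∀ w → adj x w ≡ true → Y (mate w) ≡ true ⊎ mate w ≡ x)

  insert-stable : ∀ Y x → IsStable Y → MateClosed Y → Addable Y x → IsStable (insert Y x)
  insert-stable Y x st closed (_ , Ymx , _) = stable-insert Y x st λ b Yb → ¬-not λ xb →
    true≢false (trans (sym (closed b x Yb (adj-sym xb))) Ymx)

  insert-closed : ∀ Y x → MateClosed Y → Addable Y x → MateClosed (insert Y x)
  insert-closed Y x closed (_ , _ , nbrs) s w Is sw with insert-el Y x s Is
  ... | inj₁ Ys = insert-old Y x (mate w) (closed s w Ys sw)
  ... | inj₂ refl with nbrs w sw
  ...   | inj₁ Ymw = insert-old Y x (mate w) Ymw
  ...   | inj₂ mw≡x = subst (λ z → insert Y x z ≡ true) (sym mw≡x) (insert-here Y x)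

  -- If |X| = |Y| + 1 for mate-closed stable X, Y, some x ∈ X has neither
  -- itself nor its mate in Y (else |X| ≤ |Y|); either x is addable, or a
  -- neighbour w of x spoils it, and then the pendant vertex mate w ∈ X is.
  addable-exists : ∀ X Y → IsStable X → MateClosed X → MateClosed Y → count X ≡ suc (count Y) →
    ∃[ x ] (X x ≡ true × Addable Y x)
  addable-exists X Y stX closedX closedY larger
    with any? (λ x → (X x ≟ᵇ true) ×-dec (Y x ≟ᵇ false) ×-dec (Y (mate x) ≟ᵇ false))
  ... | no none = ⊥-elim (1+n≰n (subst (_≤ count Y) larger (count-≤-via-mate X Y stX covered)))
    where
    covered : ∀ t → X t ≡ true → Y t ≡ true ⊎ Y (mate t) ≡ true
    covered t Xt with Y t in Yt | Y (mate t) in Ymt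
    ... | true | _ = inj₁ refl
    ... | false | true = inj₂ refl
    ... | false | false = ⊥-elim (none (t , Xt , Yt , Ymt))
  ... | yes (x , Xx , Yx , Ymx)
    with any? (λ w → (adj x w ≟ᵇ true) ×-dec (Y (mate w) ≟ᵇ false) ×-dec ¬? (mate w ≟ x))
  ...   | no none = x , Xx , Yx , Ymx , nbrs
    where
    nbrs : ∀ w → adj x w ≡ true → Y (mate w) ≡ true ⊎ mate w ≡ x
    nbrs w xw with Y (mate w) in Ymw
    ... | true = inj₁ refl
    ... | false = inj₂ (decidable-stable (mate w ≟ x) λ mw≢x → none (w , xw , Ymw , mw≢x))
  ...   | yes (w , xw , Ymw , mw≢x) = mate w , closedX x w Xx xw , Ymw , Ymmw , nbrs
    where
    Ymmw : Y (mate (mate w)) ≡ false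
    Ymmw = trans (cong Y (mate-involutive w))
      (¬-not λ Yw → true≢false (trans (sym (closedY w x Yw (adj-sym xw))) Ymx))
    mw-pendant : Pendant (mate w)
    mw-pendant with pendantEnd w
    ... | inj₁ w-pendant = ⊥-elim (mw≢x (sym (w-pendant x (adj-sym xw))))
    ... | inj₂ p = p
    nbrs : ∀ w′ → adj (mate w) w′ ≡ true → Y (mate w′) ≡ true ⊎ mate w′ ≡ mate w
    nbrs w′ e = inj₂ (cong mate (trans (mw-pendant w′ e) (mate-involutive w)))

  exchange : ∀ X Y → Ψ G X → Ψ G Y → ∣ X ∣ ≡ suc ∣ Y ∣ →
    ∃[ x ] (x ∈ₛ X × x ∉ₛ Y × Ψ G (Y ∪ ⁅ x ⁆))
  exchange X Y ψX ψY larger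
    with addable-exists (lookup X) (lookup Y) (Ψ⇒stable X ψX) (Ψ⇒closed X ψX) (Ψ⇒closed Y ψY)
           (trans (sym (∣∣≡count X)) (trans larger (cong suc (∣∣≡count Y))))
  ... | x , Xx , addable@(Yx , _) = x , true⇒∈ X Xx , (λ x∈Y → true≢false (trans (sym (∈⇒true Y x∈Y)) Yx)) ,
        Ψ-from (Y ∪ ⁅ x ⁆) (insert (lookup Y) x) (lookup-∪⁅⁆ Y x)
          (insert-stable (lookup Y) x (Ψ⇒stable Y ψY) (Ψ⇒closed Y ψY) addable)
          (insert-closed (lookup Y) x (Ψ⇒closed Y ψY) addable)

  greedoid : IsGreedoid n (Ψ G)
  greedoid = (⊥ₛ , Ψ-from ⊥ₛ ∅ lookup-⊥ (λ _ _ ()) (λ _ _ ())) , accessible , exchange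

corollary1 : (n : ℕ) (G : Graph n) → VeryWellCovered G → C4Free G →
    UniqueMaximumMatching G × IsGreedoid n (Ψ G)
corollary1 n G vwc c4 = uniqueMaximumMatching , greedoid
  where open VeryWellCoveredC4Free G c4 vwc
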